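{- There is no connected chordal graph $G$ such that $\gamma_t(G)=\gamma_{\rm gr}^{\rm Z}(G)=3$.
   Context: A graph is chordal if it has no induced cycle of length greater than $3$. $N(v)$ and $N[v]=N(v)\cup\{v\}$ denote open and closed neighborhoods. A total dominating set is a set $D$ such that every vertex has a neighbor in $D$; $\gamma_t(G)$ is the minimum size of one. A sequence $(v_1,\ldots,v_k)$ of distinct vertices is a Z-sequence if for every $i\in\{1,\ldots,k\}$, $N(v_i)\setminus\bigcup_{j<i}N[v_j]\ne\emptyset$; $\gamma_{\rm gr}^{\rm Z}(G)$ is the maximum length of a Z-sequence. -}

module Defs where

open import Data.Nat using (ℕ; zero; suc; _≤_; _<_)
open import Data.Fin using (Fin; toℕ)
open import Data.List using (List; length; lookup)
open import Data.List.Membership.Propositional using (_∈_)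
open import Data.List.Relation.Unary.Unique.Propositional using (Unique)
open import Data.Product using (Σ; _×_; ∃; ∃-syntax)
open import Data.Sum using (_⊎_)
open import Relation.Nullary using (¬_)
open import Relation.Binary.PropositionalEquality using (_≡_)
open import Function.Definitions using (Injective)
open import Function.Bundles using (_⇔_)

record Graph (n : ℕ) : Set₁ where
  field
    Adj   : Fin n → Fin n → Set
    sym   : ∀ {u v} → Adj u v → Adj v u
    irrefl : ∀ {v} → ¬ Adj v v

module _ {n : ℕ} (G : Graph n) where
  open Graph G

  data Reach : Fin n → Fin n → Set where
    here : ∀ {v} → Reach v v
    step : ∀ {u w v} → Adj u w → Reach w v → Reach u v

  Connected : Set
  Connected = ∀ u v → Reach u v

  InClosedNbhd : Fin n → Fin n → Set
  InClosedNbhd v w = w ≡ v ⊎ Adj v w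

  CycNext : (k : ℕ) → Fin k → Fin k → Set
  CycNext k i j = (suc (toℕ i) ≡ toℕ j) ⊎ (suc (toℕ i) ≡ k × toℕ j ≡ 0)

  InducedCycle : ℕ → Set
  InducedCycle k =
    Σ (Fin k → Fin n) λ c →
      Injective _≡_ _≡_ c ×
      (∀ i j → Adj (c i) (c j) ⇔ (CycNext k i j ⊎ CycNext k j i))

  Chordal : Set
  Chordal = ∀ k → 3 < k → ¬ InducedCycle k

  IsTDS : List (Fin n) → Set
  IsTDS D = ∀ v → ∃[ u ] (u ∈ D × Adj v u)

  TotalDominationNumber≡ : ℕ → Set
  TotalDominationNumber≡ m =
    (∃[ D ] (Unique D × IsTDS D × length D ≡ m)) ×
    (∀ D → Unique D → IsTDS D → m ≤ length D)

  IsZSeq : List (Fin n) → Set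
  IsZSeq vs = Unique vs ×
    (∀ (i : Fin (length vs)) → ∃[ w ] (Adj (lookup vs i) w ×
        (∀ (j : Fin (length vs)) → toℕ j < toℕ i → ¬ InClosedNbhd (lookup vs j) w)))

  ZGrundyNumber≡ : ℕ → Set
  ZGrundyNumber≡ m =
    (∃[ vs ] (IsZSeq vs × length vs ≡ m)) ×
    (∀ vs → IsZSeq vs → length vs ≤ m)

module Submission where

-- As γₜ > 2, no edge uv dominates G, i.e. some w lies outside N(u) ∪ N(v); as there is no
-- Z-sequence of length 4, G has no induced P₄ abcd: taking w outside N(b) ∪ N(c), if w were
-- not adjacent to a then (a, b, c, t) with t a neighbour of w would be a Z-sequence (with
-- footprints b, c, d, w); so w ~ a, symmetrically w ~ d, and abcdw is an induced C₅.
-- Finally, a connected P₄-free graph with an edge has a dominating edge: an edge uv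
-- maximising |N(u) ∪ N(v)| dominates, since a walk leaving N(u) ∪ N(v) through an edge st
-- with s ∈ N(v) either yields an induced P₄ or makes us an edge with a larger union.
-- Adjacency is only decidable up to double negation, which is enough since the goal is ⊥.

open import Defs
open import Data.Bool using (if_then_else_)
open import Data.Empty using (⊥-elim)
open import Data.Fin as Fin using (Fin; toℕ; suc)
open import Data.Fin.Patterns using (0F; 1F; 2F; 3F; 4F)
open import Data.Fin.Properties using (any?; all?; ¬∀⟶∃¬; sequence)
open import Data.Fin.Subset using (Subset; _∪_; ∣_∣; _⊆_) renaming (_∈_ to _∈ₛ_)
open import Data.Fin.Subset.Properties
  using (x∈p∪q⁺; x∈p∪q⁻; p⊂q⇒∣p∣<∣q∣; ∣p∣≤n; ∪-comm)
open import Data.List using (List; _∷_; []; length; lookup)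
open import Data.List.Relation.Unary.All using ([]; _∷_)
open import Data.List.Relation.Unary.AllPairs using ([]; _∷_)
open import Data.List.Relation.Unary.Any using (here; there)
open import Data.List.Relation.Unary.Unique.Propositional using (Unique)
open import Data.Nat as ℕ using (ℕ; _≤_; _<_; _∸_; suc; z<s; s<s; s≤s)
open import Data.Nat.Properties using (≤-pred; <-≤-trans; ∸-monoʳ-<; n<1+n)
open import Data.Product using (Σ; _×_; _,_; ∃; ∃₂; proj₂)
open import Data.Sum as Sum using (_⊎_; inj₁; inj₂; [_,_]; [_,_]′)
open import Data.Vec as Vec using (tabulate; _∷_; [])
open import Data.Vec.Properties using (lookup∘tabulate; lookup⇒[]=; []=⇒lookup)
open import Effect.Monad using (RawMonad)
open import Function using (_∘_; const)
open import Function.Bundles using (_⇔_; mk⇔; Equivalence)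
open import Function.Definitions using (Injective)
open import Relation.Binary.Definitions using (Decidable)
open import Relation.Binary.PropositionalEquality
  using (_≡_; _≢_; refl; trans; cong; subst; ≢-sym) renaming (sym to sym≡)
open import Relation.Nullary using (¬_; Dec; yes; no; does; ¬?)
open import Relation.Nullary.Decidable
  using (_×-dec_; _⊎-dec_; from-yes; dec-true; ¬¬-excluded-middle)
open import Relation.Nullary.Negation using (¬¬-Monad)

¬¬-decidable : ∀ {n} (R : Fin n → Fin n → Set) → ¬ ¬ Decidable R
¬¬-decidable R =
  sequence rawApplicative λ u → sequence rawApplicative λ v → ¬¬-excluded-middle
  where open RawMonad ¬¬-Monad using (rawApplicative)

ascent : ∀ {a p} {A : Set a} {P : A → Set p} (f : A → ℕ) {m : ℕ} →
         (∀ x → f x ≤ m) → (∀ x → P x ⊎ ∃ λ y → f x < f y) → A → ∃ P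
ascent {P = P} f {m} f≤m improve x = go (suc (m ∸ f x)) x (n<1+n _)
  where
  go : ∀ k x → m ∸ f x < k → ∃ P
  go 0 x ()
  go (suc k) x gap<k with improve x
  ... | inj₁ Px = x , Px
  ... | inj₂ (y , fx<fy) = go k y (<-≤-trans (∸-monoʳ-< fx<fy (f≤m y)) (≤-pred gap<k))

decided⇔ : ∀ {a b} {A : Set a} {B : Set b} (B? : Dec B) →
           (if does B? then A else ¬ A) → A ⇔ B
decided⇔ (yes b) a  = mk⇔ (const b) (const a)
decided⇔ (no ¬b) ¬a = mk⇔ (⊥-elim ∘ ¬a) (⊥-elim ∘ ¬b)

module _ {n : ℕ} (G : Graph n) where
  open Graph G

  private
    variable
      a b c d s t u v w x y z : Fin n

  adj⇒≢ : Adj x y → x ≢ y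
  adj⇒≢ xy refl = irrefl xy

  separated : ¬ Adj x z → Adj y z → x ≢ y
  separated ¬xz yz refl = ¬xz yz

  ∉N[] : x ≢ y → ¬ Adj x y → ¬ InClosedNbhd G x y
  ∉N[] x≢y ¬xy = [ ≢-sym x≢y , ¬xy ]

  record InducedP4 (a b c d : Fin n) : Set where
    constructor mkP4
    field
      ab  : Adj a b
      bc  : Adj b c
      cd  : Adj c d
      ¬ac : ¬ Adj a c
      ¬ad : ¬ Adj a d
      ¬bd : ¬ Adj b d

  P4Free : Set
  P4Free = ∀ {a b c d} → ¬ InducedP4 a b c d

  reverseP4 : InducedP4 a b c d → InducedP4 d c b a
  reverseP4 (mkP4 ab bc cd ¬ac ¬ad ¬bd) =
    mkP4 (sym cd) (sym bc) (sym ab) (¬bd ∘ sym) (¬ad ∘ sym) (¬ac ∘ sym)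

  Z4Free : Set
  Z4Free = ∀ {a b c d} → ¬ IsZSeq G (a ∷ b ∷ c ∷ d ∷ [])

  P4⇒ZSeq : InducedP4 a b c d → Adj t w → ¬ Adj a w → ¬ Adj b w → ¬ Adj c w →
            IsZSeq G (a ∷ b ∷ c ∷ t ∷ [])
  P4⇒ZSeq {a} {b} {c} {d} {t} {w} (mkP4 ab bc cd ¬ac ¬ad ¬bd) tw ¬aw ¬bw ¬cw =
    distinct , footprint
    where
    a≢c : a ≢ c
    a≢c = separated ¬ad cd
    a≢d : a ≢ d
    a≢d = separated ¬ac (sym cd)
    b≢d : b ≢ d
    b≢d = ≢-sym (separated (¬ad ∘ sym) (sym ab))
    a≢w : a ≢ w
    a≢w = ≢-sym (separated (¬bw ∘ sym) ab)
    b≢w : b ≢ w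
    b≢w = ≢-sym (separated (¬cw ∘ sym) bc)
    c≢w : c ≢ w
    c≢w = ≢-sym (separated (¬bw ∘ sym) (sym bc))

    vs : List (Fin n)
    vs = a ∷ b ∷ c ∷ t ∷ []

    distinct : Unique vs
    distinct = (adj⇒≢ ab ∷ a≢c ∷ separated ¬aw tw ∷ [])
             ∷ (adj⇒≢ bc ∷ separated ¬bw tw ∷ [])
             ∷ (separated ¬cw tw ∷ [])
             ∷ [] ∷ []

    footprint : ∀ i → ∃ λ x → Adj (lookup vs i) x ×
                  (∀ j → toℕ j < toℕ i → ¬ InClosedNbhd G (lookup vs j) x)
    footprint 0F = b , ab , λ _ ()
    footprint 1F = c , bc , λ { 0F _ → ∉N[] a≢c ¬ac ; (suc _) (s<s ()) }
    footprint 2F = d , cd , λ { 0F _ → ∉N[] a≢d ¬ad ; 1F _ → ∉N[] b≢d ¬bd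
                              ; (suc (suc _)) (s<s (s<s ())) }
    footprint 3F = w , tw , λ { 0F _ → ∉N[] a≢w ¬aw ; 1F _ → ∉N[] b≢w ¬bw
                              ; 2F _ → ∉N[] c≢w ¬cw
                              ; (suc (suc (suc _))) (s<s (s<s (s<s ()))) }

  CycAdj : ∀ k → Fin k → Fin k → Set
  CycAdj k i j = CycNext G k i j ⊎ CycNext G k j i

  cycNext? : ∀ k (i j : Fin k) → Dec (CycNext G k i j)
  cycNext? k i j = (suc (toℕ i) ℕ.≟ toℕ j) ⊎-dec ((suc (toℕ i) ℕ.≟ k) ×-dec (toℕ j ℕ.≟ 0))

  cycAdj? : ∀ k (i j : Fin k) → Dec (CycAdj k i j)
  cycAdj? k i j = cycNext? k i j ⊎-dec cycNext? k j i

  -- Holds for k ≥ 5; for k = 4 opposite positions have the same neighbours.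
  PositionsSeparated : ℕ → Set
  PositionsSeparated k = ∀ i j → i ≡ j ⊎ ∃ λ l → CycAdj k i l × ¬ CycAdj k j l

  positionsSeparated₅ : PositionsSeparated 5
  positionsSeparated₅ = from-yes (all? λ i → all? λ j →
    (i Fin.≟ j) ⊎-dec any? λ l → cycAdj? 5 i l ×-dec ¬? (cycAdj? 5 j l))

  CyclePattern : ∀ {k} → (Fin k → Fin n) → Set
  CyclePattern {k} c =
    ∀ i j → if does (cycAdj? k i j) then Adj (c i) (c j) else ¬ Adj (c i) (c j)

  inducedCycle : ∀ {k} → PositionsSeparated k → (c : Fin k → Fin n) → CyclePattern c →
                 InducedCycle G k
  inducedCycle {k} separate c shape = c , injective , adj⇔
    where
    adj⇔ : ∀ i j → Adj (c i) (c j) ⇔ CycAdj k i j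
    adj⇔ i j = decided⇔ (cycAdj? k i j) (shape i j)

    injective : Injective _≡_ _≡_ c
    injective {i} {j} cᵢ≡cⱼ with separate i j
    ... | inj₁ i≡j = i≡j
    ... | inj₂ (l , il , ¬jl) =
      ⊥-elim (¬jl (Equivalence.to (adj⇔ j l)
             (subst (λ x → Adj x (c l)) cᵢ≡cⱼ (Equivalence.from (adj⇔ i l) il))))

  P4+apex⇒C5 : InducedP4 a b c d → Adj d w → Adj w a → ¬ Adj b w → ¬ Adj c w →
               InducedCycle G 5
  P4+apex⇒C5 {a} {b} {c} {d} {w} (mkP4 ab bc cd ¬ac ¬ad ¬bd) dw wa ¬bw ¬cw =
    inducedCycle positionsSeparated₅ (Vec.lookup (a ∷ b ∷ c ∷ d ∷ w ∷ [])) shape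
    where
    shape : CyclePattern (Vec.lookup (a ∷ b ∷ c ∷ d ∷ w ∷ []))
    shape 0F 0F = irrefl
    shape 0F 1F = ab
    shape 0F 2F = ¬ac
    shape 0F 3F = ¬ad
    shape 0F 4F = sym wa
    shape 1F 0F = sym ab
    shape 1F 1F = irrefl
    shape 1F 2F = bc
    shape 1F 3F = ¬bd
    shape 1F 4F = ¬bw
    shape 2F 0F = ¬ac ∘ sym
    shape 2F 1F = sym bc
    shape 2F 2F = irrefl
    shape 2F 3F = cd
    shape 2F 4F = ¬cw
    shape 3F 0F = ¬ad ∘ sym
    shape 3F 1F = ¬bd ∘ sym
    shape 3F 2F = sym cd
    shape 3F 3F = irrefl
    shape 3F 4F = dw
    shape 4F 0F = wa
    shape 4F 1F = ¬bw ∘ sym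
    shape 4F 2F = ¬cw ∘ sym
    shape 4F 3F = sym dw
    shape 4F 4F = irrefl

  crossing-edge : ∀ {P : Fin n → Set} → (∀ x → Dec (P x)) →
                  Reach G u v → P u → ¬ P v → ∃₂ λ s t → P s × ¬ P t × Adj s t
  crossing-edge P? here Pu ¬Pv = ⊥-elim (¬Pv Pu)
  crossing-edge P? (step {w = x} ux xv) Pu ¬Pv with P? x
  ... | yes Px = crossing-edge P? xv Px ¬Pv
  ... | no ¬Px = _ , x , Pu , ¬Px , ux

  Edge : Set
  Edge = ∃₂ λ u v → Adj u v

  Dominates : Fin n → Fin n → Set
  Dominates u v = ∀ w → Adj w u ⊎ Adj w v

  DominatingEdge : Edge → Set
  DominatingEdge (u , v , _) = Dominates u v

  Dominates⇒IsTDS : Dominates u v → IsTDS G (u ∷ v ∷ [])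
  Dominates⇒IsTDS {u} {v} dom w =
    [ (λ wu → u , here refl , wu) , (λ wv → v , there (here refl) , wv) ]′ (dom w)

  IsTDS⇒no-isolated : ∀ {D} → IsTDS G D → ∀ v → ∃ (Adj v)
  IsTDS⇒no-isolated D-total v with D-total v
  ... | u , _ , vu = u , vu

  γₜ≥3⇒¬Dominates : (∀ D → Unique D → IsTDS G D → 3 ≤ length D) →
                     Adj u v → ¬ Dominates u v
  γₜ≥3⇒¬Dominates {u} {v} γₜ≥3 uv dom
    with γₜ≥3 (u ∷ v ∷ []) ((adj⇒≢ uv ∷ []) ∷ [] ∷ []) (Dominates⇒IsTDS dom)
  ... | s≤s (s≤s ())

  γᶻ≤3⇒Z4Free : (∀ vs → IsZSeq G vs → length vs ≤ 3) → Z4Free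
  γᶻ≤3⇒Z4Free γᶻ≤3 z with γᶻ≤3 _ z
  ... | s≤s (s≤s (s≤s ()))

  module _ (adj? : Decidable Adj) where

    dominates? : ∀ u v → Dec (Dominates u v)
    dominates? u v = all? λ w → adj? w u ⊎-dec adj? w v

    undominated-vertex : ¬ Dominates u v → ∃ λ w → ¬ (Adj w u ⊎ Adj w v)
    undominated-vertex {u} {v} = ¬∀⟶∃¬ n _ (λ w → adj? w u ⊎-dec adj? w v)

    adjacent-to-P4-end : Z4Free → (∀ v → ∃ (Adj v)) →
                         InducedP4 a b c d → ¬ Adj w b → ¬ Adj w c → Adj w a
    adjacent-to-P4-end {a} {w = w} noZ4 nbr p ¬wb ¬wc with adj? w a
    ... | yes wa = wa
    ... | no ¬wa =
      ⊥-elim (noZ4 (P4⇒ZSeq p (sym (proj₂ (nbr w))) (¬wa ∘ sym) (¬wb ∘ sym) (¬wc ∘ sym)))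

    chordal⇒P4Free : Chordal G → Z4Free → (∀ {u v} → Adj u v → ¬ Dominates u v) →
                     (∀ v → ∃ (Adj v)) → P4Free
    chordal⇒P4Free chordal noZ4 noDom nbr {a} {b} {c} {d} p
      with undominated-vertex (noDom (InducedP4.bc p))
    ... | w , ¬w = chordal 5 (s<s (s<s (s<s z<s)))
      (P4+apex⇒C5 p (sym wd) wa (¬wb ∘ sym) (¬wc ∘ sym))
      where
      ¬wb : ¬ Adj w b
      ¬wb = ¬w ∘ inj₁
      ¬wc : ¬ Adj w c
      ¬wc = ¬w ∘ inj₂
      wa : Adj w a
      wa = adjacent-to-P4-end noZ4 nbr p ¬wb ¬wc
      wd : Adj w d
      wd = adjacent-to-P4-end noZ4 nbr (reverseP4 p) ¬wc ¬wb

    nbhd : Fin n → Subset n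
    nbhd u = tabulate λ w → does (adj? u w)

    ∈nbhd⁺ : Adj u w → w ∈ₛ nbhd u
    ∈nbhd⁺ {u} {w} uw =
      lookup⇒[]= w (nbhd u) (trans (lookup∘tabulate _ w) (dec-true (adj? u w) uw))

    ∈nbhd⁻ : w ∈ₛ nbhd u → Adj u w
    ∈nbhd⁻ {w} {u} w∈ with adj? u w | trans (sym≡ (lookup∘tabulate _ w)) ([]=⇒lookup w∈)
    ... | yes uw | _ = uw
    ... | no _   | ()

    span : Fin n → Fin n → ℕ
    span u v = ∣ nbhd u ∪ nbhd v ∣

    span-comm : ∀ u v → span u v ≡ span v u
    span-comm u v = cong ∣_∣ (∪-comm (nbhd u) (nbhd v))

    span-< : (∀ x → Adj v x → Adj u x ⊎ Adj s x) → Adj s t → ¬ Adj u t → ¬ Adj v t →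
             span u v < span u s
    span-< {v} {u} {s} {t} N[v]⊆ st ¬ut ¬vt =
      p⊂q⇒∣p∣<∣q∣ (⊆ , t , x∈p∪q⁺ (inj₂ (∈nbhd⁺ st)) , t∉)
      where
      ⊆ : nbhd u ∪ nbhd v ⊆ nbhd u ∪ nbhd s
      ⊆ {x} x∈ = x∈p∪q⁺ ([ inj₁ , Sum.map ∈nbhd⁺ ∈nbhd⁺ ∘ N[v]⊆ x ∘ ∈nbhd⁻ ]′
                            (x∈p∪q⁻ (nbhd u) (nbhd v) x∈))
      t∉ : ¬ t ∈ₛ nbhd u ∪ nbhd v
      t∉ t∈ = [ ¬ut ∘ ∈nbhd⁻ , ¬vt ∘ ∈nbhd⁻ ]′ (x∈p∪q⁻ (nbhd u) (nbhd v) t∈)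

    edge-span : Edge → ℕ
    edge-span (u , v , _) = span u v

    module _ (P4free : P4Free) where

      wider-edge : Adj u v → Adj v s → Adj s t → ¬ Adj u t → ¬ Adj v t →
                   ∃ λ e → span u v < edge-span e
      wider-edge {u} {v} {s} {t} uv vs st ¬ut ¬vt with adj? u s
      ... | no ¬us = ⊥-elim (P4free (mkP4 uv vs st ¬us ¬ut ¬vt))
      ... | yes us with any? (λ r → adj? v r ×-dec ¬? (adj? u r) ×-dec ¬? (adj? s r))
      ...   | no none = (u , s , us) , span-< N[v]⊆ st ¬ut ¬vt
        where
        N[v]⊆ : ∀ x → Adj v x → Adj u x ⊎ Adj s x
        N[v]⊆ x vx with adj? u x | adj? s x
        ... | yes ux | _      = inj₁ ux
        ... | no _   | yes sx = inj₂ sx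
        ... | no ¬ux | no ¬sx = ⊥-elim (none (x , vx , ¬ux , ¬sx))
      ...   | yes (r , vr , ¬ur , ¬sr) with adj? r t
      ...     | yes rt = ⊥-elim (P4free (mkP4 uv vr rt ¬ur ¬ut ¬vt))
      ...     | no ¬rt = ⊥-elim (P4free (mkP4 (sym vr) vs st (¬sr ∘ sym) ¬rt ¬vt))

      undominated-edge-widens : Connected G → ∀ e → ¬ DominatingEdge e →
                                ∃ λ e′ → edge-span e < edge-span e′
      undominated-edge-widens connected (u , v , uv) ¬dom
        with undominated-vertex ¬dom
      ... | w , ¬w
        with crossing-edge (λ x → adj? u x ⊎-dec adj? v x) (connected v w) (inj₁ uv)
                           (¬w ∘ Sum.map sym sym)
      ... | s , t , inj₂ vs , ¬t , st = wider-edge uv vs st (¬t ∘ inj₁) (¬t ∘ inj₂)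
      ... | s , t , inj₁ us , ¬t , st =
        subst (λ m → ∃ λ e′ → m < edge-span e′) (span-comm v u)
              (wider-edge (sym uv) us st (¬t ∘ inj₂) (¬t ∘ inj₁))

      dominating-edge : Connected G → Edge → ∃ DominatingEdge
      dominating-edge connected =
        ascent edge-span (λ (u , v , _) → ∣p∣≤n (nbhd u ∪ nbhd v)) improve
        where
        improve : ∀ e → DominatingEdge e ⊎ ∃ λ e′ → edge-span e < edge-span e′
        improve e@(u , v , _) with dominates? u v
        ... | yes dom = inj₁ dom
        ... | no ¬dom = inj₂ (undominated-edge-widens connected e ¬dom)

corollary3p7 : ¬ (Σ ℕ λ n → Σ (Graph n) λ G →
                 Connected G × Chordal G ×
                 TotalDominationNumber≡ G 3 × ZGrundyNumber≡ G 3)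
corollary3p7 (n , G , connected , chordal , ((d ∷ _ , _ , D-total , _) , γₜ≥3) , (_ , γᶻ≤3)) =
  ¬¬-decidable (Graph.Adj G) λ adj? →
    let P4free = chordal⇒P4Free G adj? chordal (γᶻ≤3⇒Z4Free G γᶻ≤3)
                                no-dominating-edge no-isolated
        ((_ , _ , uv) , dom) = dominating-edge G adj? P4free connected (d , no-isolated d)
    in no-dominating-edge uv dom
  where
  no-dominating-edge : ∀ {u v} → Graph.Adj G u v → ¬ Dominates G u v
  no-dominating-edge = γₜ≥3⇒¬Dominates G γₜ≥3
  no-isolated : ∀ v → ∃ (Graph.Adj G v)
  no-isolated = IsTDS⇒no-isolated G D-total
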